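{- Let $G$ be a finite simple graph and $S\subseteq V(G)$. Then $\det(G|_S)=1$ if and only if there exists a sequence of pivots $\varphi$ with $\sup(\varphi)=S$ that is applicable to $G$; moreover, in that case such a $\varphi$ can be chosen to be reduced.
   Context: $G|_S$ is the induced subgraph; $\det H$ is the determinant over $GF(2)$ of the adjacency matrix of $H$ (empty determinant $=1$). For a vertex $x$, $N'(x)=N(x)\cup\{x\}$. Pivot: for an edge $\{u,v\}$, let $V_1=N'(u)\setminus N'(v)$, $V_2=N'(v)\setminus N'(u)$, $V_3=N'(u)\cap N'(v)$; $G[uv]$ is obtained by toggling every pair $\{x,y\}$ with $x\in V_i$, $y\in V_j$, $i\neq j$. A sequence $[v_1v_2]\cdots[v_{n-1}v_n]$ is applicable to $G$ if each $\{v_i,v_{i+1}\}$ is an edge of the graph obtained by applying the preceding pivots. The support $\sup(\varphi)=\{v_1\}\oplus\cdots\oplus\{v_n\}$ is the set of vertices occurring an odd number of times. A sequence is reduced if no vertex occurs more than once in it. -}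

module Defs where

open import Data.Nat using (ℕ; zero; suc)
open import Data.Bool using (Bool; true; false; _∧_; _∨_; _xor_; not)
open import Data.Fin using (Fin; zero; suc; _≟_; punchIn)
open import Data.Fin.Subset using (Subset)
open import Data.List using (List; []; _∷_; length; _++_)
open import Data.List.Relation.Unary.Unique.Propositional using (Unique)
open import Data.Product using (_×_; _,_; proj₁; proj₂)
open import Data.Vec using (Vec; []; _∷_; tabulate)
import Data.List as L
open import Relation.Nullary.Decidable using (⌊_⌋)
open import Relation.Binary.PropositionalEquality using (_≡_)

Adj : ℕ → Set
Adj n = Fin n → Fin n → Bool

record Graph (n : ℕ) : Set where
  field
    adj    : Adj n
    sym    : ∀ x y → adj x y ≡ adj y x
    irrefl : ∀ x → adj x x ≡ false
open Graph public

_==_ : ∀ {n} → Fin n → Fin n → Bool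
x == y = ⌊ x ≟ y ⌋

-- Determinant over GF(2) (Laplace expansion along the first row;
-- signs are irrelevant in characteristic 2).  det of the 0×0 matrix = 1.

xorSum : ∀ {k} → (Fin k → Bool) → Bool
xorSum {zero}  f = false
xorSum {suc k} f = f zero xor xorSum (λ i → f (suc i))

det : ∀ {k} → (Fin k → Fin k → Bool) → Bool
det {zero}  M = true
det {suc k} M = xorSum (λ j → M zero j ∧ det (λ r c → M (suc r) (punchIn j c)))

-- Induced subgraph G|_S: adjacency matrix restricted to the elements of S
-- (listed in increasing order).

members : ∀ {n} → Subset n → List (Fin n)
members {zero}  []          = []
members {suc n} (true  ∷ s) = zero ∷ L.map suc (members s)
members {suc n} (false ∷ s) = L.map suc (members s)

inducedMatrix : ∀ {n} → Adj n → (S : Subset n) →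
                Fin (length (members S)) → Fin (length (members S)) → Bool
inducedMatrix A S i j = A (L.lookup (members S) i) (L.lookup (members S) j)

detInduced : ∀ {n} → Graph n → Subset n → Bool
detInduced G S = det (inducedMatrix (adj G) S)

N' : ∀ {n} → Adj n → Fin n → Fin n → Bool
N' A x y = (x == y) ∨ A x y

-- x,y lie in V1 ∪ V2 ∪ V3 and in different classes Vi ≠ Vj.
-- The class of x is determined by the pair (x ∈ N'(u), x ∈ N'(v)).
pivotAdj : ∀ {n} → Adj n → Fin n → Fin n → Adj n
pivotAdj A u v x y =
  let ux = N' A u x ; vx = N' A v x ; uy = N' A u y ; vy = N' A v y
      inX = ux ∨ vx ; inY = uy ∨ vy
      differ = (ux xor uy) ∨ (vx xor vy)
  in A x y xor (inX ∧ inY ∧ differ)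

-- Pivot sequences [v1 v2][v3 v4]⋯ as lists of pairs.

PivotSeq : ℕ → Set
PivotSeq n = List (Fin n × Fin n)

Applicable : ∀ {n} → Adj n → PivotSeq n → Set
Applicable A []            = Data.Unit.⊤ where import Data.Unit
Applicable A ((u , v) ∷ φ) = (A u v ≡ true) × Applicable (pivotAdj A u v) φ

vertices : ∀ {n} → PivotSeq n → List (Fin n)
vertices []            = []
vertices ((u , v) ∷ φ) = u ∷ v ∷ vertices φ

supp : ∀ {n} → PivotSeq n → Subset n
supp φ = tabulate (λ x → L.foldr (λ y b → (y == x) xor b) false (vertices φ))

Reduced : ∀ {n} → PivotSeq n → Set
Reduced φ = Unique (vertices φ)

module Submission where

-- Everything rests on one identity: for an edge uv of G and any vertex set T,
--     det(G[uv]|_T) = det(G|_(T ⊕ {u,v}))                       (pivot-minor).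
-- Soundness follows by induction along the sequence, since the support of
-- [uv]φ is supp(φ) ⊕ {u,v}.  Completeness is an induction on |S|: expanding
-- det(G|_S) = 1 along the row of the first vertex u of S yields v ∈ S with uv an
-- edge; then det(G[uv]|_(S ⊕ {u,v})) = 1 on a smaller set, and the sequence
-- obtained recursively avoids u and v, so prefixing [uv] keeps it reduced.

open import Defs hiding (sym)
open import Data.Nat using (zero; suc; _≤_; s≤s)
open import Data.Nat.Properties using (≤-refl; ≤-trans; n≤1+n; suc-injective)
open import Data.Bool using (Bool; true; false; _∧_; _∨_; _xor_; not; if_then_else_)
open import Data.Bool.Properties
  using (xor-identityʳ; xor-assoc; xor-comm; ∧-zeroʳ; ∨-zeroʳ; ∧-distribˡ-xor)
open import Data.Bool.Solver using (module xor-∧-Solver)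
open import Data.Fin using (Fin; zero; suc; _≟_; punchIn)
open import Data.Fin.Subset using (Subset)
open import Data.List using (List; []; _∷_; map; length)
import Data.List as L
open import Data.List.Properties using (map-∘; map-id-local; map-tabulate; tabulate-lookup)
open import Data.List.Membership.Propositional using (_∈_)
open import Data.List.Membership.Propositional.Properties using (∈-map⁺; ∈-map⁻)
open import Data.List.Relation.Unary.Any using (here; there)
open import Data.List.Relation.Unary.All using (All; []; _∷_; universal)
import Data.List.Relation.Unary.All as All
open import Data.List.Relation.Unary.All.Properties using (map⁺)
open import Data.List.Relation.Unary.AllPairs using ([]; _∷_)
open import Data.List.Relation.Binary.Pointwise using (Pointwise; []; _∷_)
import Data.List.Relation.Binary.Pointwise as Pointwise
open import Data.List.Relation.Binary.Permutation.Propositional using (_↭_)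
import Data.List.Relation.Binary.Permutation.Propositional as ↭
import Data.List.Relation.Binary.Permutation.Propositional.Properties as ↭ₚ
open import Data.List.Relation.Binary.Permutation.Propositional.Properties using (↭-length)
open import Data.Product using (_×_; _,_; proj₁; proj₂; ∃-syntax)
open import Data.Sum using (_⊎_; inj₁; inj₂)
open import Data.Vec using (Vec; []; _∷_; tabulate; lookup)
open import Data.Vec.Properties using (lookup∘tabulate; tabulate∘lookup; tabulate-cong)
open import Relation.Nullary using (Dec; yes; no; contradiction)
open import Relation.Binary.PropositionalEquality
  using (_≡_; _≢_; _≗_; ≢-sym; refl; sym; trans; cong; cong₂; subst; module ≡-Reasoning)

open xor-∧-Solver using (solve; _:=_; _:+_; _:*_; con)

private variable
  V : Set

xor-interchange : ∀ a b c d → (a xor b) xor (c xor d) ≡ (a xor c) xor (b xor d)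
xor-interchange = solve 4 (λ a b c d → (a :+ b) :+ (c :+ d) := (a :+ c) :+ (b :+ d)) refl

xor-rotate : ∀ a b c → a xor (b xor c) ≡ b xor (a xor c)
xor-rotate = solve 3 (λ a b c → a :+ (b :+ c) := b :+ (a :+ c)) refl

∧-rotate : ∀ a b c → a ∧ (b ∧ c) ≡ b ∧ (a ∧ c)
∧-rotate = solve 3 (λ a b c → a :* (b :* c) := b :* (a :* c)) refl

data Pick {V : Set} : List V → V → List V → Set where
  here  : ∀ {c cs} → Pick (c ∷ cs) c cs
  there : ∀ {c cs d r} → Pick cs d r → Pick (c ∷ cs) d (c ∷ r)

pick-∈ : ∀ {cs : List V} {d r} → Pick cs d r → d ∈ cs
pick-∈ here      = here refl
pick-∈ (there p) = there (pick-∈ p)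

pick-⊆ : ∀ {cs : List V} {d r x} → Pick cs d r → x ∈ r → x ∈ cs
pick-⊆ here      m         = there m
pick-⊆ (there p) (here e)  = here e
pick-⊆ (there p) (there m) = there (pick-⊆ p m)

pick-split : ∀ {cs : List V} {d r x} → Pick cs d r → x ∈ cs → d ≡ x ⊎ x ∈ r
pick-split here      (here e)  = inj₁ (sym e)
pick-split here      (there m) = inj₂ m
pick-split (there p) (here e)  = inj₂ (here e)
pick-split (there p) (there m) with pick-split p m
... | inj₁ e  = inj₁ e
... | inj₂ m′ = inj₂ (there m′)

-- pickSum F cs = ⊕ of F d r over all picks (d , r) of cs, summed in GF(2).
pickSum : (V → List V → Bool) → List V → Bool
pickSum F []       = false
pickSum F (c ∷ cs) = F c cs xor pickSum (λ d r → F d (c ∷ r)) cs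

pickSum-cong : ∀ (cs : List V) {F G} → (∀ d r → Pick cs d r → F d r ≡ G d r) →
               pickSum F cs ≡ pickSum G cs
pickSum-cong []       h = refl
pickSum-cong (c ∷ cs) h =
  cong₂ _xor_ (h c cs here) (pickSum-cong cs (λ d r p → h d (c ∷ r) (there p)))

pickSum-vanish : ∀ (cs : List V) {F} → (∀ d r → Pick cs d r → F d r ≡ false) →
                 pickSum F cs ≡ false
pickSum-vanish []       h = refl
pickSum-vanish (c ∷ cs) h rewrite h c cs here =
  pickSum-vanish cs (λ d r p → h d (c ∷ r) (there p))

pickSum-xor : ∀ (cs : List V) F G →
              pickSum (λ d r → F d r xor G d r) cs ≡ pickSum F cs xor pickSum G cs
pickSum-xor []       F G = refl
pickSum-xor (c ∷ cs) F G =
  trans (cong ((F c cs xor G c cs) xor_) (pickSum-xor cs _ _))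
        (xor-interchange (F c cs) (G c cs) _ _)

pickSum-scale : ∀ (cs : List V) a F → pickSum (λ d r → a ∧ F d r) cs ≡ a ∧ pickSum F cs
pickSum-scale []       a F = sym (∧-zeroʳ a)
pickSum-scale (c ∷ cs) a F =
  trans (cong ((a ∧ F c cs) xor_) (pickSum-scale cs a _)) (sym (∧-distribˡ-xor a _ _))

pickSum-witness : ∀ (cs : List V) F → pickSum F cs ≡ true →
                  ∃[ d ] ∃[ r ] (Pick cs d r × F d r ≡ true)
pickSum-witness []       F ()
pickSum-witness (c ∷ cs) F h with F c cs in eq
... | true  = c , cs , here , eq
... | false with pickSum-witness cs _ h
...   | d , r , p , e = d , c ∷ r , there p , e

pickSum-comm : ∀ (cs ds : List V) (G : V → List V → V → List V → Bool) →
  pickSum (λ c r → pickSum (λ d s → G c r d s) ds) cs ≡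
  pickSum (λ d s → pickSum (λ c r → G c r d s) cs) ds
pickSum-comm []       ds G = sym (pickSum-vanish ds (λ _ _ _ → refl))
pickSum-comm (c ∷ cs) ds G =
  trans (cong (pickSum (λ d s → G c cs d s) ds xor_) (pickSum-comm cs ds (λ c′ r → G c′ (c ∷ r))))
        (sym (pickSum-xor ds _ _))

pickSum-map : ∀ (σ : V → V) (cs : List V) F →
              pickSum F (map σ cs) ≡ pickSum (λ d r → F (σ d) (map σ r)) cs
pickSum-map σ []       F = refl
pickSum-map σ (c ∷ cs) F = cong (F (σ c) (map σ cs) xor_) (pickSum-map σ cs (λ d r → F d (σ c ∷ r)))

pickSum-perm : ∀ {cs cs′ : List V} → cs ↭ cs′ → ∀ F →
               (∀ d r r′ → r ↭ r′ → F d r ≡ F d r′) → pickSum F cs ≡ pickSum F cs′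
pickSum-perm ↭.refl F h = refl
pickSum-perm (↭.prep {xs = xs} {ys = ys} x p) F h =
  cong₂ _xor_ (h x xs ys p) (pickSum-perm p (λ d r → F d (x ∷ r)) (λ d r r′ q → h d _ _ (↭.prep x q)))
pickSum-perm (↭.swap {xs = xs} {ys = ys} x y p) F h =
  trans (cong₂ (λ a b → a xor (b xor pickSum (λ d r → F d (x ∷ y ∷ r)) xs))
               (h x _ _ (↭.prep y p)) (h y _ _ (↭.prep x p)))
  (trans (xor-rotate (F x (y ∷ ys)) (F y (x ∷ ys)) _)
  (cong (λ z → F y (x ∷ ys) xor (F x (y ∷ ys) xor z))
        (trans (pickSum-perm p (λ d r → F d (x ∷ y ∷ r)) (λ d r r′ q → h d _ _ (↭.prep x (↭.prep y q))))
               (pickSum-cong ys (λ d r _ → h d _ _ (↭.swap x y ↭.refl))))))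
pickSum-perm (↭.trans p q) F h = trans (pickSum-perm p F h) (pickSum-perm q F h)

pairSum : (V → V → List V → Bool) → List V → Bool
pairSum g = pickSum (λ d r → pickSum (λ d′ r′ → g d d′ r′) r)

pairSum-unfold : ∀ (x : V) xs g → pairSum g (x ∷ xs) ≡
  pickSum (λ d r → g x d r) xs xor
  (pickSum (λ d r → g d x r) xs xor pairSum (λ d d′ r → g d d′ (x ∷ r)) xs)
pairSum-unfold x xs g =
  cong (pickSum (λ d r → g x d r) xs xor_) (pickSum-xor xs (λ d r → g d x r) (λ d r → pickSum (λ d′ r′ → g d d′ (x ∷ r′)) r))

pairSum-flip : ∀ (cs : List V) g → pairSum g cs ≡ pairSum (λ d d′ r → g d′ d r) cs
pairSum-flip []       g = refl
pairSum-flip (x ∷ xs) g =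
  trans (pairSum-unfold x xs g)
  (trans (xor-rotate (pickSum (λ d r → g x d r) xs) (pickSum (λ d r → g d x r) xs)
                     (pairSum (λ d d′ r → g d d′ (x ∷ r)) xs))
  (trans (cong (λ z → pickSum (λ d r → g d x r) xs xor (pickSum (λ d r → g x d r) xs xor z))
               (pairSum-flip xs (λ d d′ r → g d d′ (x ∷ r))))
         (sym (pairSum-unfold x xs (λ d d′ r → g d′ d r)))))

pairSum-symmetric : ∀ (cs : List V) g → (∀ d d′ r → g d d′ r ≡ g d′ d r) → pairSum g cs ≡ false
pairSum-symmetric []       g h = refl
pairSum-symmetric (x ∷ xs) g h =
  trans (pairSum-unfold x xs g)
  (trans (cong₂ (λ a c → a xor (pickSum (λ d r → g d x r) xs xor c))
                (pickSum-cong xs (λ d r _ → h x d r))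
                (pairSum-symmetric xs _ (λ d d′ r → h d d′ (x ∷ r))))
         (solve 1 (λ b → b :+ (b :+ con false) := con false) refl (pickSum (λ d r → g d x r) xs)))

-- The determinant over GF(2) of the square array (f c), f ∈ fs, c ∈ cs, given by
-- expansion along the first row; it is false when the lengths differ.
detL : List (V → Bool) → List V → Bool
detL []       []      = true
detL []       (_ ∷ _) = false
detL (f ∷ fs) cs      = pickSum (λ d r → f d ∧ detL fs r) cs

minor : (V → V → Bool) → List V → List V → Bool
minor M rs cs = detL (map M rs) cs

AgreeOn : List V → (V → Bool) → (V → Bool) → Set
AgreeOn cs f g = ∀ c → c ∈ cs → f c ≡ g c

detL-cong : ∀ (fs gs : List (V → Bool)) cs → Pointwise (AgreeOn cs) fs gs → detL fs cs ≡ detL gs cs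
detL-cong []       []       cs []       = refl
detL-cong (f ∷ fs) (g ∷ gs) cs (e ∷ es) =
  pickSum-cong cs (λ d r p → cong₂ _∧_ (e d (pick-∈ p))
    (detL-cong fs gs r (Pointwise.map (λ h c m → h c (pick-⊆ p m)) es)))

pointwise-map : ∀ {A B C : Set} {Q : B → C → Set} (f : A → B) (g : A → C) (xs : List A) →
                (∀ x → x ∈ xs → Q (f x) (g x)) → Pointwise Q (map f xs) (map g xs)
pointwise-map f g []       h = []
pointwise-map f g (x ∷ xs) h = h x (here refl) ∷ pointwise-map f g xs (λ y m → h y (there m))

minor-cong : ∀ (M N : V → V → Bool) rs cs → (∀ x → x ∈ rs → ∀ c → c ∈ cs → M x c ≡ N x c) →
             minor M rs cs ≡ minor N rs cs
minor-cong M N rs cs h = detL-cong (map M rs) (map N rs) cs (pointwise-map M N rs h)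

-- Swapping the first two rows (no sign in characteristic 2).
detL-swap : ∀ (f g : V → Bool) fs cs → detL (f ∷ g ∷ fs) cs ≡ detL (g ∷ f ∷ fs) cs
detL-swap f g fs cs =
  trans (pickSum-cong cs (λ d r _ → sym (pickSum-scale r (f d) (λ d′ r′ → g d′ ∧ detL fs r′))))
  (trans (pairSum-flip cs (λ d d′ r → f d ∧ (g d′ ∧ detL fs r)))
  (trans (pickSum-cong cs (λ d r _ → pickSum-cong r (λ d′ r′ _ → ∧-rotate (f d′) (g d) (detL fs r′))))
         (pickSum-cong cs (λ d r _ → pickSum-scale r (g d) (λ d′ r′ → f d′ ∧ detL fs r′)))))

detL-repeat : ∀ (f : V → Bool) fs cs → detL (f ∷ f ∷ fs) cs ≡ false
detL-repeat f fs cs =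
  trans (pickSum-cong cs (λ d r _ → sym (pickSum-scale r (f d) (λ d′ r′ → f d′ ∧ detL fs r′))))
        (pairSum-symmetric cs (λ d d′ r → f d ∧ (f d′ ∧ detL fs r))
                           (λ d d′ r → ∧-rotate (f d) (f d′) (detL fs r)))

detL-tail : ∀ (f : V → Bool) fs gs → (∀ cs → detL fs cs ≡ detL gs cs) →
            ∀ cs → detL (f ∷ fs) cs ≡ detL (f ∷ gs) cs
detL-tail f fs gs h cs = pickSum-cong cs (λ d r _ → cong (f d ∧_) (h r))

detL-permRows : ∀ {fs gs : List (V → Bool)} → fs ↭ gs → ∀ cs → detL fs cs ≡ detL gs cs
detL-permRows ↭.refl                               cs = refl
detL-permRows (↭.prep {xs = xs} {ys = ys} f p)     cs = detL-tail f xs ys (detL-permRows p) cs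
detL-permRows (↭.swap {xs = xs} {ys = ys} f g p)   cs =
  trans (detL-tail f (g ∷ xs) (g ∷ ys) (detL-tail g xs ys (detL-permRows p)) cs) (detL-swap f g ys cs)
detL-permRows (↭.trans p q)                        cs = trans (detL-permRows p cs) (detL-permRows q cs)

detL-permCols : ∀ (fs : List (V → Bool)) {cs cs′} → cs ↭ cs′ → detL fs cs ≡ detL fs cs′
detL-permCols []       {[]}    {[]}    p = refl
detL-permCols []       {[]}    {_ ∷ _} p with ↭-length p
... | ()
detL-permCols []       {_ ∷ _} {[]}    p with ↭-length p
... | ()
detL-permCols []       {_ ∷ _} {_ ∷ _} p = refl
detL-permCols (f ∷ fs) p = pickSum-perm p _ (λ d r r′ q → cong (f d ∧_) (detL-permCols fs q))

minor-perm : ∀ (M : V → V → Bool) {xs ys} → xs ↭ ys → minor M xs xs ≡ minor M ys ys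
minor-perm M {xs} {ys} p =
  trans (detL-permRows (↭ₚ.map⁺ M p) xs) (detL-permCols (map M ys) p)

detL-linear : ∀ (f g h : V → Bool) a fs cs → (∀ c → f c ≡ g c xor (a ∧ h c)) →
  detL (f ∷ fs) cs ≡ detL (g ∷ fs) cs xor (a ∧ detL (h ∷ fs) cs)
detL-linear f g h a fs cs e =
  trans (pickSum-cong cs (λ d r _ → trans (cong (_∧ detL fs r) (e d)) (distrib (g d) a (h d) (detL fs r))))
  (trans (pickSum-xor cs _ _) (cong (detL (g ∷ fs) cs xor_) (pickSum-scale cs a _)))
  where
  distrib : ∀ x a y z → (x xor (a ∧ y)) ∧ z ≡ (x ∧ z) xor (a ∧ (y ∧ z))
  distrib = solve 4 (λ x a y z → (x :+ (a :* y)) :* z := (x :* z) :+ (a :* (y :* z))) refl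

RowOp : (V → Bool) → (V → Bool) → (V → Bool) → Set
RowOp f g g′ = ∃[ a ] (∀ c → g′ c ≡ g c xor (a ∧ f c))

detL-rowop : ∀ (f : V → Bool) gs gs′ → Pointwise (RowOp f) gs gs′ →
             ∀ cs → detL (f ∷ gs′) cs ≡ detL (f ∷ gs) cs
detL-rowop f []       []         []              cs = refl
detL-rowop f (g ∷ gs) (g′ ∷ gs′) ((a , e) ∷ ops) cs = begin
  detL (f ∷ g′ ∷ gs′) cs                                    ≡⟨ detL-swap f g′ gs′ cs ⟩
  detL (g′ ∷ f ∷ gs′) cs                                    ≡⟨ detL-linear g′ g f a (f ∷ gs′) cs e ⟩
  detL (g ∷ f ∷ gs′) cs xor (a ∧ detL (f ∷ f ∷ gs′) cs)     ≡⟨ cong (λ z → D xor (a ∧ z)) (detL-repeat f gs′ cs) ⟩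
  detL (g ∷ f ∷ gs′) cs xor (a ∧ false)                      ≡⟨ cong (D xor_) (∧-zeroʳ a) ⟩
  detL (g ∷ f ∷ gs′) cs xor false                            ≡⟨ xor-identityʳ D ⟩
  detL (g ∷ f ∷ gs′) cs                                     ≡⟨ detL-tail g (f ∷ gs′) (f ∷ gs) (detL-rowop f gs gs′ ops) cs ⟩
  detL (g ∷ f ∷ gs) cs                                      ≡⟨ detL-swap g f gs cs ⟩
  detL (f ∷ g ∷ gs) cs                                      ∎
  where
  open ≡-Reasoning
  D : Bool
  D = detL (g ∷ f ∷ gs′) cs

detL-zeroColumn : ∀ (fs : List (V → Bool)) cs x → x ∈ cs → All (λ f → f x ≡ false) fs →
                  detL fs cs ≡ false
detL-zeroColumn []       (_ ∷ _) x m []       = refl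
detL-zeroColumn (f ∷ fs) cs      x m (z ∷ zs) = pickSum-vanish cs term
  where
  term : ∀ d r → Pick cs d r → f d ∧ detL fs r ≡ false
  term d r p with pick-split p m
  ... | inj₁ refl rewrite z = refl
  ... | inj₂ m′ rewrite detL-zeroColumn fs r x m′ zs = ∧-zeroʳ (f d)

detL-unitColumn : ∀ (f : V → Bool) gs c cs → All (λ g → g c ≡ false) gs →
                  detL (f ∷ gs) (c ∷ cs) ≡ f c ∧ detL gs cs
detL-unitColumn f gs c cs zs =
  trans (cong ((f c ∧ detL gs cs) xor_)
              (pickSum-vanish cs (λ d r _ →
                 trans (cong (f d ∧_) (detL-zeroColumn gs (c ∷ r) c (here refl) zs)) (∧-zeroʳ (f d)))))
        (xor-identityʳ _)

detL-relabel : ∀ (σ : V → V) (fs : List (V → Bool)) cs →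
               detL fs (map σ cs) ≡ detL (map (λ f c → f (σ c)) fs) cs
detL-relabel σ []       []      = refl
detL-relabel σ []       (_ ∷ _) = refl
detL-relabel σ (f ∷ fs) cs =
  trans (pickSum-map σ cs _) (pickSum-cong cs (λ d r _ → cong (f (σ d) ∧_) (detL-relabel σ fs r)))

minor-relabel : ∀ (σ : V → V) (M : V → V → Bool) rs cs →
                minor M (map σ rs) (map σ cs) ≡ minor (λ x c → M (σ x) (σ c)) rs cs
minor-relabel σ M rs cs =
  trans (cong (λ fs → detL fs (map σ cs)) (sym (map-∘ rs))) (trans (detL-relabel σ (map (λ x → M (σ x)) rs) cs)
        (cong (λ fs → detL fs cs) (sym (map-∘ rs))))

minor-columnExpansion : ∀ (M : V → V → Bool) r rs c cs →
  minor M (r ∷ rs) (c ∷ cs) ≡ pickSum (λ r′ rest → M r′ c ∧ minor M rest cs) (r ∷ rs)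
minor-columnExpansion M r [] c cs =
  cong ((M r c ∧ detL [] cs) xor_) (pickSum-vanish cs (λ d _ _ → ∧-zeroʳ (M r d)))
minor-columnExpansion M r (s ∷ ss) c cs =
  cong ((M r c ∧ minor M (s ∷ ss) cs) xor_)
  (trans (pickSum-cong cs (λ d r₀ _ → trans (cong (M r d ∧_) (minor-columnExpansion M s ss c r₀))
            (sym (pickSum-scale (s ∷ ss) (M r d) (λ r′ rest → M r′ c ∧ minor M rest r₀)))))
  (trans (pickSum-comm cs (s ∷ ss) (λ d r₀ r′ rest → M r d ∧ (M r′ c ∧ minor M rest r₀)))
         (pickSum-cong (s ∷ ss) (λ r′ rest _ →
            trans (pickSum-cong cs (λ d r₀ _ → ∧-rotate (M r d) (M r′ c) (minor M rest r₀)))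
                  (pickSum-scale cs (M r′ c) (λ d r₀ → M r d ∧ minor M rest r₀))))))

minor-transpose : ∀ (M : V → V → Bool) rs cs → minor M rs cs ≡ minor (λ x y → M y x) cs rs
minor-transpose M []       []       = refl
minor-transpose M []       (c ∷ cs) = refl
minor-transpose M (r ∷ rs) []       = refl
minor-transpose M (r ∷ rs) (c ∷ cs) =
  trans (minor-columnExpansion M r rs c cs)
        (pickSum-cong (r ∷ rs) (λ d rest _ → cong (M d c ∧_) (minor-transpose M rest cs)))

minor-nonzeroRow : ∀ (M : V → V → Bool) x rs cs → minor M (x ∷ rs) cs ≡ true →
                   ∃[ c ] (c ∈ cs × M x c ≡ true)
minor-nonzeroRow M x rs cs h with pickSum-witness cs _ h
... | c , r , p , e = c , pick-∈ p , ∧-true e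
  where
  ∧-true : ∀ {a b} → a ∧ b ≡ true → a ≡ true
  ∧-true {true} _ = refl


xorSum-cong : ∀ {k} {f g : Fin k → Bool} → (∀ j → f j ≡ g j) → xorSum f ≡ xorSum g
xorSum-cong {zero}  h = refl
xorSum-cong {suc k} h = cong₂ _xor_ (h zero) (xorSum-cong (λ j → h (suc j)))

-- Omitting column j of a tabulated list is a pick.
xorSum-pickSum : ∀ {V : Set} {k} (c : Fin (suc k) → V) F →
  xorSum (λ j → F (c j) (L.tabulate (λ i → c (punchIn j i)))) ≡ pickSum F (L.tabulate c)
xorSum-pickSum {k = zero}  c F = refl
xorSum-pickSum {k = suc k} c F =
  cong (F (c zero) (L.tabulate (λ i → c (suc i))) xor_)
       (xorSum-pickSum (λ i → c (suc i)) (λ d r → F d (c zero ∷ r)))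

det-detL : ∀ {V : Set} {k} (R : Fin k → V → Bool) (c : Fin k → V) →
           det (λ i j → R i (c j)) ≡ detL (L.tabulate R) (L.tabulate c)
det-detL {k = zero}  R c = refl
det-detL {k = suc k} R c =
  trans (xorSum-cong (λ j → cong (R zero (c j) ∧_) (det-detL (λ i → R (suc i)) (λ i → c (punchIn j i)))))
        (xorSum-pickSum c (λ d r → R zero d ∧ detL (L.tabulate (λ i → R (suc i))) r))

minorOn : ∀ {n} → Adj n → Subset n → Bool
minorOn A S = minor A (members S) (members S)

det-induced : ∀ {n} (A : Adj n) S → det (inducedMatrix A S) ≡ minorOn A S
det-induced A S = trans (det-detL (λ i → A (L.lookup ms i)) (L.lookup ms))
  (cong₂ detL (trans (sym (map-tabulate (L.lookup ms) A)) (cong (map A) (tabulate-lookup ms)))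
              (tabulate-lookup ms))
  where ms = members S

minorOn-cong : ∀ {n} {A A′ : Adj n} → (∀ x y → A x y ≡ A′ x y) → ∀ S → minorOn A S ≡ minorOn A′ S
minorOn-cong h S = minor-cong _ _ (members S) (members S) (λ x _ c _ → h x c)

==-refl : ∀ {n} (x : Fin n) → (x == x) ≡ true
==-refl x with x ≟ x
... | yes _ = refl
... | no x≢x = contradiction refl x≢x

==-distinct : ∀ {n} {x y : Fin n} → x ≢ y → (x == y) ≡ false
==-distinct {x = x} {y} x≢y with x ≟ y
... | yes x≡y = contradiction x≡y x≢y
... | no _    = refl

==-suc : ∀ {n} (x y : Fin n) → (suc x == suc y) ≡ (x == y)
==-suc x y with x ≟ y
... | yes refl = refl
... | no _     = refl

vec-ext : ∀ {n} {A : Set} (s t : Vec A n) → (∀ i → lookup s i ≡ lookup t i) → s ≡ t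
vec-ext s t h = trans (sym (tabulate∘lookup s)) (trans (tabulate-cong h) (tabulate∘lookup t))

toggle : ∀ {n} → Fin n → Subset n → Subset n
toggle x S = tabulate (λ y → (x == y) xor lookup S y)

lookup-toggle : ∀ {n} (x : Fin n) S y → lookup (toggle x S) y ≡ (x == y) xor lookup S y
lookup-toggle x S y = lookup∘tabulate _ y

toggle-other : ∀ {n} {x y : Fin n} S → x ≢ y → lookup (toggle x S) y ≡ lookup S y
toggle-other {x = x} {y} S x≢y = trans (lookup-toggle x S y) (cong (_xor lookup S y) (==-distinct x≢y))

toggle-involutive : ∀ {n} (x : Fin n) S → toggle x (toggle x S) ≡ S
toggle-involutive x S = vec-ext _ S λ y → begin
  lookup (toggle x (toggle x S)) y      ≡⟨ lookup-toggle x (toggle x S) y ⟩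
  (x == y) xor lookup (toggle x S) y    ≡⟨ cong ((x == y) xor_) (lookup-toggle x S y) ⟩
  (x == y) xor ((x == y) xor lookup S y) ≡⟨ solve 2 (λ a b → a :+ (a :+ b) := b) refl (x == y) (lookup S y) ⟩
  lookup S y                            ∎
  where open ≡-Reasoning

toggle-comm : ∀ {n} (x y : Fin n) S → toggle x (toggle y S) ≡ toggle y (toggle x S)
toggle-comm x y S = vec-ext _ _ λ z →
  trans (trans (lookup-toggle x (toggle y S) z) (cong ((x == z) xor_) (lookup-toggle y S z)))
  (trans (xor-rotate (x == z) (y == z) (lookup S z))
         (sym (trans (lookup-toggle y (toggle x S) z) (cong ((y == z) xor_) (lookup-toggle x S z)))))

lookup-toggle-self : ∀ {n} (x : Fin n) S → lookup (toggle x S) x ≡ not (lookup S x)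
lookup-toggle-self x S = trans (lookup-toggle x S x) (cong (_xor lookup S x) (==-refl x))

toggle-twice : ∀ {n} (u v : Fin n) T → toggle u (toggle v (toggle u (toggle v T))) ≡ T
toggle-twice u v T = begin
  toggle u (toggle v (toggle u (toggle v T)))  ≡⟨ cong (toggle u) (toggle-comm v u (toggle v T)) ⟩
  toggle u (toggle u (toggle v (toggle v T)))  ≡⟨ toggle-involutive u (toggle v (toggle v T)) ⟩
  toggle v (toggle v T)                        ≡⟨ toggle-involutive v T ⟩
  T                                            ∎
  where open ≡-Reasoning

∈members⇒ : ∀ {n} (S : Subset n) {x} → x ∈ members S → lookup S x ≡ true
∈members⇒ (true ∷ S)  (here refl) = refl
∈members⇒ (true ∷ S)  (there m) with ∈-map⁻ suc m
... | y , m′ , refl = ∈members⇒ S m′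
∈members⇒ (false ∷ S) m with ∈-map⁻ suc m
... | y , m′ , refl = ∈members⇒ S m′

⇒∈members : ∀ {n} (S : Subset n) {x} → lookup S x ≡ true → x ∈ members S
⇒∈members (true ∷ S)  {zero}  h = here refl
⇒∈members (true ∷ S)  {suc x} h = there (∈-map⁺ suc (⇒∈members S h))
⇒∈members (false ∷ S) {suc x} h = ∈-map⁺ suc (⇒∈members S h)

∉members : ∀ {n} (S : Subset n) {x y} → lookup S x ≡ false → y ∈ members S → y ≢ x
∉members S Sx m refl with trans (sym (∈members⇒ S m)) Sx
... | ()

members-toggle : ∀ {n} (x : Fin n) S → lookup S x ≡ false → members (toggle x S) ↭ x ∷ members S
members-toggle zero    (false ∷ S) refl =
  subst (λ T → members (true ∷ T) ↭ zero ∷ members (false ∷ S)) (sym (tabulate∘lookup S)) ↭.refl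
members-toggle (suc x) (b ∷ S)     Sx   =
  subst (λ T → members T ↭ suc x ∷ members (b ∷ S)) (sym toggle-suc) (add b)
  where
  toggle-suc : toggle (suc x) (b ∷ S) ≡ b ∷ toggle x S
  toggle-suc = cong (b ∷_) (tabulate-cong (λ y → cong (_xor lookup S y) (==-suc x y)))
  shifted : L.map suc (members (toggle x S)) ↭ suc x ∷ L.map suc (members S)
  shifted = ↭ₚ.map⁺ suc (members-toggle x S Sx)
  add : ∀ b → members (b ∷ toggle x S) ↭ suc x ∷ members (b ∷ S)
  add false = shifted
  add true  = ↭.trans (↭.prep zero shifted) (↭.swap zero (suc x) ↭.refl)

members-toggle₂ : ∀ {n} (u v : Fin n) S → lookup S u ≡ false → lookup S v ≡ false → u ≢ v →
                  members (toggle u (toggle v S)) ↭ u ∷ v ∷ members S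
members-toggle₂ u v S Su Sv u≢v =
  ↭.trans (members-toggle u (toggle v S) (trans (toggle-other S (≢-sym u≢v)) Su))
          (↭.prep u (members-toggle v S Sv))


-- The set toggled by a pivot between x and y, in terms of the indicators
-- p = [x ∈ N'(u)], q = [x ∈ N'(v)], s = [y ∈ N'(u)], t = [y ∈ N'(v)].
pivot-toggle : ∀ p q s t → (p ∨ q) ∧ ((s ∨ t) ∧ ((p xor s) ∨ (q xor t))) ≡ (q ∧ s) xor (p ∧ t)
pivot-toggle true  true  true  true  = refl
pivot-toggle true  true  true  false = refl
pivot-toggle true  true  false true  = refl
pivot-toggle true  true  false false = refl
pivot-toggle true  false true  true  = refl
pivot-toggle true  false true  false = refl
pivot-toggle true  false false true  = refl
pivot-toggle true  false false false = refl
pivot-toggle false true  true  true  = refl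
pivot-toggle false true  true  false = refl
pivot-toggle false true  false true  = refl
pivot-toggle false true  false false = refl
pivot-toggle false false true  true  = refl
pivot-toggle false false true  false = refl
pivot-toggle false false false true  = refl
pivot-toggle false false false false = refl

pivot-formula : ∀ {n} (A : Adj n) u v x y →
  pivotAdj A u v x y ≡ A x y xor ((N' A v x ∧ N' A u y) xor (N' A u x ∧ N' A v y))
pivot-formula A u v x y = cong (A x y xor_) (pivot-toggle (N' A u x) (N' A v x) (N' A u y) (N' A v y))

pivot-comm : ∀ {n} (A : Adj n) u v x y → pivotAdj A u v x y ≡ pivotAdj A v u x y
pivot-comm A u v x y =
  trans (pivot-formula A u v x y)
  (trans (cong (A x y xor_) (xor-comm (N' A v x ∧ N' A u y) (N' A u x ∧ N' A v y)))
         (sym (pivot-formula A v u x y)))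

pivotGraph : ∀ {n} → Graph n → Fin n → Fin n → Graph n
pivotGraph G u v = record
  { adj    = pivotAdj A u v
  ; sym    = λ x y → trans (pivot-formula A u v x y)
               (trans (cong₂ _xor_ (Graph.sym G x y)
                             (rank2-sym (N' A u x) (N' A v x) (N' A u y) (N' A v y)))
                      (sym (pivot-formula A u v y x)))
  ; irrefl = λ x → trans (pivot-formula A u v x x)
               (cong₂ _xor_ (irrefl G x) (rank2-diag (N' A u x) (N' A v x)))
  }
  where
  A = adj G
  rank2-sym : ∀ p q s t → (q ∧ s) xor (p ∧ t) ≡ (t ∧ p) xor (s ∧ q)
  rank2-sym = solve 4 (λ p q s t → (q :* s) :+ (p :* t) := (t :* p) :+ (s :* q)) refl
  rank2-diag : ∀ p q → (q ∧ p) xor (p ∧ q) ≡ false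
  rank2-diag = solve 2 (λ p q → (q :* p) :+ (p :* q) := con false) refl

N'-self : ∀ {n} (A : Adj n) x → N' A x x ≡ true
N'-self A x rewrite ==-refl x = refl

N'-distinct : ∀ {n} (A : Adj n) {x y} → x ≢ y → N' A x y ≡ A x y
N'-distinct A x≢y rewrite ==-distinct x≢y = refl

N'-edge : ∀ {n} (A : Adj n) {x y} → A x y ≡ true → N' A x y ≡ true
N'-edge A {x} {y} e rewrite e = ∨-zeroʳ (x == y)

N'-cong : ∀ {n} {A B : Adj n} → (∀ x y → A x y ≡ B x y) → ∀ x y → N' A x y ≡ N' B x y
N'-cong h x y = cong ((x == y) ∨_) (h x y)

module _ {n} (G : Graph n) {u v : Fin n} (uv : adj G u v ≡ true) where
  private
    A = adj G
    B = pivotAdj A u v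

  edge-sym : A v u ≡ true
  edge-sym = trans (Graph.sym G v u) uv

  edge-distinct : u ≢ v
  edge-distinct refl with trans (sym uv) (irrefl G u)
  ... | ()

  pivot-N'u : ∀ x → N' B u x ≡ N' A v x
  pivot-N'u x = by-cases (u ≟ x)
    where
    open ≡-Reasoning
    by-cases : Dec (u ≡ x) → N' B u x ≡ N' A v x
    by-cases (yes refl) = trans (N'-self B u) (sym (N'-edge A edge-sym))
    by-cases (no u≢x) = begin
      N' B u x                                                     ≡⟨ N'-distinct B u≢x ⟩
      B u x                                                        ≡⟨ pivot-formula A u v u x ⟩
      A u x xor ((N' A v u ∧ N' A u x) xor (N' A u u ∧ N' A v x)) ≡⟨ cong₂ (λ p q → A u x xor ((p ∧ N' A u x) xor (q ∧ N' A v x)))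
                                                                        (N'-edge A edge-sym) (N'-self A u) ⟩
      A u x xor (N' A u x xor N' A v x)                           ≡⟨ cong (λ p → A u x xor (p xor N' A v x)) (N'-distinct A u≢x) ⟩
      A u x xor (A u x xor N' A v x)                              ≡⟨ solve 2 (λ a b → a :+ (a :+ b) := b) refl (A u x) (N' A v x) ⟩
      N' A v x                                                     ∎

  pivot-edge : B u v ≡ true
  pivot-edge = trans (sym (N'-distinct B edge-distinct)) (trans (pivot-N'u v) (N'-self A v))

  pivot-row : ∀ {c} → c ≢ u → c ≢ v → B u c ≡ A v c
  pivot-row {c} c≢u c≢v = begin
    B u c     ≡⟨ sym (N'-distinct B (≢-sym c≢u)) ⟩
    N' B u c  ≡⟨ pivot-N'u _ ⟩
    N' A v c  ≡⟨ N'-distinct A (≢-sym c≢v) ⟩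
    A v c     ∎
    where open ≡-Reasoning

  pivot-entry : ∀ {x c} → x ≢ u → x ≢ v → c ≢ u → c ≢ v →
                B x c ≡ A x c xor ((A x v ∧ A u c) xor (A x u ∧ A v c))
  pivot-entry {x} {c} x≢u x≢v c≢u c≢v =
    trans (pivot-formula A u v x c)
          (cong₂ (λ a b → A x c xor (a xor b))
                 (cong₂ _∧_ (trans (N'-distinct A (≢-sym x≢v)) (Graph.sym G v x)) (N'-distinct A (≢-sym c≢u)))
                 (cong₂ _∧_ (trans (N'-distinct A (≢-sym x≢u)) (Graph.sym G u x)) (N'-distinct A (≢-sym c≢v))))

pivot-N'v : ∀ {n} (G : Graph n) {u v} (uv : adj G u v ≡ true) →
            ∀ x → N' (pivotAdj (adj G) u v) v x ≡ N' (adj G) u x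
pivot-N'v G {u} {v} uv x = trans (N'-cong (pivot-comm (adj G) u v) v x) (pivot-N'u G (edge-sym G uv) x)

pivot-involutive : ∀ {n} (G : Graph n) {u v} (uv : adj G u v ≡ true) →
                   ∀ x y → pivotAdj (pivotAdj (adj G) u v) u v x y ≡ adj G x y
pivot-involutive G {u} {v} uv x y = begin
  pivotAdj B u v x y                                                ≡⟨ pivot-formula B u v x y ⟩
  B x y xor ((N' B v x ∧ N' B u y) xor (N' B u x ∧ N' B v y))       ≡⟨ cong₂ (λ a b → B x y xor (a xor b))
                                                                         (cong₂ _∧_ (pivot-N'v G uv x) (pivot-N'u G uv y))
                                                                         (cong₂ _∧_ (pivot-N'u G uv x) (pivot-N'v G uv y)) ⟩
  B x y xor ((N' A u x ∧ N' A v y) xor (N' A v x ∧ N' A u y))       ≡⟨ cong (_xor ((N' A u x ∧ N' A v y) xor (N' A v x ∧ N' A u y)))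
                                                                         (pivot-formula A u v x y) ⟩
  (A x y xor ((N' A v x ∧ N' A u y) xor (N' A u x ∧ N' A v y)))
    xor ((N' A u x ∧ N' A v y) xor (N' A v x ∧ N' A u y))           ≡⟨ solve 5 (λ a p q s t → (a :+ ((q :* s) :+ (p :* t))) :+ ((p :* t) :+ (q :* s)) := a)
                                                                         refl (A x y) (N' A u x) (N' A v x) (N' A u y) (N' A v y) ⟩
  A x y                                                             ∎
  where
  open ≡-Reasoning
  A = adj G
  B = pivotAdj A u v

Avoids : ∀ {n} → Fin n → Fin n → List (Fin n) → Set
Avoids u v R = ∀ {x} → x ∈ R → x ≢ u × x ≢ v

module _ {n} (G : Graph n) {u v : Fin n} (uv : adj G u v ≡ true) where
  private
    A = adj G
    B = pivotAdj A u v
    open ≡-Reasoning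

    unchanged : ∀ (f g : Fin n → Bool) → RowOp f g g
    unchanged f g = false , λ c → sym (xor-identityʳ (g c))

  -- Elimination (both pivot vertices outside the minor): using rows u and v to
  -- clear columns v and u turns A on {u,v} ∪ R into a block matrix with the
  -- unit 2×2 block on {u,v} and the pivot B on R.
  elimination : ∀ R → Avoids u v R → minor B R R ≡ minor A (u ∷ v ∷ R) (u ∷ v ∷ R)
  elimination R avoid = sym (begin
    detL (A u ∷ A v ∷ map A R) cs                ≡⟨ sym (detL-rowop (A u) (A v ∷ map A R) (A v ∷ map clear-v R) by-row-u cs) ⟩
    detL (A u ∷ A v ∷ map clear-v R) cs          ≡⟨ detL-swap (A u) (A v) (map clear-v R) cs ⟩
    detL (A v ∷ A u ∷ map clear-v R) cs          ≡⟨ sym (detL-rowop (A v) (A u ∷ map clear-v R) (A u ∷ map clear-uv R) by-row-v cs) ⟩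
    detL (A v ∷ A u ∷ map clear-uv R) cs         ≡⟨ detL-unitColumn (A v) (A u ∷ map clear-uv R) u (v ∷ R)
                                                       (irrefl G u ∷ map⁺ (universal cleared-u R)) ⟩
    A v u ∧ detL (A u ∷ map clear-uv R) (v ∷ R)  ≡⟨ cong (_∧ detL (A u ∷ map clear-uv R) (v ∷ R)) (edge-sym G uv) ⟩
    detL (A u ∷ map clear-uv R) (v ∷ R)          ≡⟨ detL-unitColumn (A u) (map clear-uv R) v R (map⁺ (universal cleared-v R)) ⟩
    A u v ∧ minor clear-uv R R                   ≡⟨ cong (_∧ minor clear-uv R R) uv ⟩
    minor clear-uv R R                           ≡⟨ minor-cong clear-uv B R R entries ⟩
    minor B R R                                  ∎)
    where
    cs = u ∷ v ∷ R
    clear-v clear-uv : Fin n → Fin n → Bool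
    clear-v  x c = A x c xor (A x v ∧ A u c)
    clear-uv x c = clear-v x c xor (A x u ∧ A v c)
    by-row-u : Pointwise (RowOp (A u)) (A v ∷ map A R) (A v ∷ map clear-v R)
    by-row-u = unchanged (A u) (A v) ∷ pointwise-map A clear-v R (λ x _ → A x v , λ c → refl)
    by-row-v : Pointwise (RowOp (A v)) (A u ∷ map clear-v R) (A u ∷ map clear-uv R)
    by-row-v = unchanged (A v) (A u) ∷ pointwise-map clear-v clear-uv R (λ x _ → A x u , λ c → refl)

    cleared-u : ∀ x → clear-uv x u ≡ false
    cleared-u x =
      trans (cong₂ (λ p q → (A x u xor (A x v ∧ p)) xor (A x u ∧ q)) (irrefl G u) (edge-sym G uv))
            (solve 2 (λ a b → (a :+ (b :* con false)) :+ (a :* con true) := con false) refl (A x u) (A x v))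

    cleared-v : ∀ x → clear-uv x v ≡ false
    cleared-v x =
      trans (cong₂ (λ p q → (A x v xor (A x v ∧ p)) xor (A x u ∧ q)) uv (irrefl G v))
            (solve 2 (λ a b → (a :+ (a :* con true)) :+ (b :* con false) := con false) refl (A x v) (A x u))

    entries : ∀ x → x ∈ R → ∀ c → c ∈ R → clear-uv x c ≡ B x c
    entries x mx c mc with avoid mx | avoid mc
    ... | x≢u , x≢v | c≢u , c≢v =
      trans (xor-assoc (A x c) (A x v ∧ A u c) (A x u ∧ A v c))
            (sym (pivot-entry G uv x≢u x≢v c≢u c≢v))

  cleared : Fin n → Fin n → Bool
  cleared x c = B x c xor (A x u ∧ B u c)

  cleared-row-u : ∀ c → cleared u c ≡ B u c
  cleared-row-u c = trans (cong (λ a → B u c xor (a ∧ B u c)) (irrefl G u)) (xor-identityʳ (B u c))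

  cleared-uu : cleared u u ≡ false
  cleared-uu = trans (cleared-row-u u) (irrefl (pivotGraph G u v) u)

  cleared-col-u : ∀ {c} → c ≢ u → c ≢ v → cleared c u ≡ A c v
  cleared-col-u {c} c≢u c≢v = begin
    B c u xor (A c u ∧ B u u)   ≡⟨ cong₂ (λ a b → a xor (A c u ∧ b)) B-cu (irrefl (pivotGraph G u v) u) ⟩
    A c v xor (A c u ∧ false)   ≡⟨ solve 2 (λ a b → a :+ (b :* con false) := a) refl (A c v) (A c u) ⟩
    A c v                       ∎
    where
    B-cu : B c u ≡ A c v
    B-cu = trans (Graph.sym (pivotGraph G u v) c u) (trans (pivot-row G uv c≢u c≢v) (Graph.sym G v c))

  cleared-inner : ∀ {c x} → c ≢ u → c ≢ v → x ≢ u → x ≢ v → cleared c x ≡ A c x xor (A c v ∧ A x u)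
  cleared-inner {c} {x} c≢u c≢v x≢u x≢v = begin
    B c x xor (A c u ∧ B u x)                                            ≡⟨ cong₂ (λ a b → a xor (A c u ∧ b))
                                                                              (pivot-entry G uv c≢u c≢v x≢u x≢v) (pivot-row G uv x≢u x≢v) ⟩
    (A c x xor ((A c v ∧ A u x) xor (A c u ∧ A v x))) xor (A c u ∧ A v x) ≡⟨ cong (λ a → (A c x xor ((A c v ∧ a) xor (A c u ∧ A v x))) xor (A c u ∧ A v x))
                                                                              (Graph.sym G u x) ⟩
    (A c x xor ((A c v ∧ A x u) xor (A c u ∧ A v x))) xor (A c u ∧ A v x) ≡⟨ solve 5 (λ a p q r s → (a :+ ((p :* q) :+ (r :* s))) :+ (r :* s) := a :+ (p :* q))
                                                                              refl (A c x) (A c v) (A x u) (A c u) (A v x) ⟩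
    A c x xor (A c v ∧ A x u)                                            ∎

  -- Exchange (exactly one pivot vertex inside the minor): after clearing the
  -- u-column of B by row u, transposing, and clearing the u-row by column u,
  -- one is left with the entries of A, u playing the role of v.
  exchange : ∀ R → Avoids u v R → minor B (u ∷ R) (u ∷ R) ≡ minor A (v ∷ R) (v ∷ R)
  exchange R avoid = begin
    detL (B u ∷ map B R) cs               ≡⟨ sym (detL-rowop (B u) (map B R) (map P R)
                                                (pointwise-map B P R (λ x _ → A x u , λ c → refl)) cs) ⟩
    detL (B u ∷ map P R) cs               ≡⟨ detL-cong (B u ∷ map P R) (map P cs) cs
                                                ((λ c _ → sym (cleared-row-u c)) ∷ pointwise-map P P R (λ _ _ _ _ → refl)) ⟩
    minor P cs cs                         ≡⟨ minor-transpose P cs cs ⟩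
    detL (Pᵀ u ∷ map Pᵀ R) cs             ≡⟨ sym (detL-rowop (Pᵀ u) (map Pᵀ R) (map Q R)
                                                (pointwise-map Pᵀ Q R (λ x _ → A x u , λ c → refl)) cs) ⟩
    detL (Pᵀ u ∷ map Q R) cs              ≡⟨ detL-cong (Pᵀ u ∷ map Q R) (map Aσ cs) cs
                                                (head-entries ∷ pointwise-map Q Aσ R tail-entries) ⟩
    minor Aσ cs cs                        ≡⟨ sym (minor-relabel σ A cs cs) ⟩
    minor A (map σ cs) (map σ cs)         ≡⟨ cong (λ l → minor A l l) σ-list ⟩
    minor A (v ∷ R) (v ∷ R)               ∎
    where
    cs = u ∷ R
    P Pᵀ Q Aσ : Fin n → Fin n → Bool
    P      = cleared
    Pᵀ x c = P c x
    Q x c  = Pᵀ x c xor (A x u ∧ Pᵀ u c)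
    σ : Fin n → Fin n
    σ x = if u == x then v else x
    Aσ x c = A (σ x) (σ c)

    σ-u : σ u ≡ v
    σ-u rewrite ==-refl u = refl
    σ-R : ∀ {x} → x ∈ R → σ x ≡ x
    σ-R m rewrite ==-distinct (≢-sym (proj₁ (avoid m))) = refl
    σ-list : map σ cs ≡ v ∷ R
    σ-list = cong₂ _∷_ σ-u (map-id-local (All.tabulate σ-R))

    head-entries : AgreeOn cs (Pᵀ u) (Aσ u)
    head-entries .u (here refl) = trans cleared-uu (sym (trans (cong₂ A σ-u σ-u) (irrefl G v)))
    head-entries c  (there m)   =
      trans (cleared-col-u (proj₁ (avoid m)) (proj₂ (avoid m))) (trans (Graph.sym G c v) (sym (cong₂ A σ-u (σ-R m))))

    tail-entries : ∀ x → x ∈ R → AgreeOn cs (Q x) (Aσ x)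
    tail-entries x mx .u (here refl) = begin
      P u x xor (A x u ∧ P u u)   ≡⟨ cong₂ (λ a b → a xor (A x u ∧ b)) (cleared-row-u x) cleared-uu ⟩
      B u x xor (A x u ∧ false)   ≡⟨ solve 2 (λ a b → a :+ (b :* con false) := a) refl (B u x) (A x u) ⟩
      B u x                       ≡⟨ pivot-row G uv (proj₁ (avoid mx)) (proj₂ (avoid mx)) ⟩
      A v x                       ≡⟨ Graph.sym G v x ⟩
      A x v                       ≡⟨ sym (cong₂ A (σ-R mx) σ-u) ⟩
      Aσ x u                      ∎
    tail-entries x mx c (there mc) with avoid mc | avoid mx
    ... | c≢u , c≢v | x≢u , x≢v = begin
      P c x xor (A x u ∧ P c u)                          ≡⟨ cong₂ (λ a b → a xor (A x u ∧ b))
                                                              (cleared-inner c≢u c≢v x≢u x≢v) (cleared-col-u c≢u c≢v) ⟩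
      (A c x xor (A c v ∧ A x u)) xor (A x u ∧ A c v)    ≡⟨ solve 3 (λ a p q → (a :+ (p :* q)) :+ (q :* p) := a) refl (A c x) (A c v) (A x u) ⟩
      A c x                                              ≡⟨ Graph.sym G c x ⟩
      A x c                                              ≡⟨ sym (cong₂ A (σ-R mx) (σ-R mc)) ⟩
      Aσ x c                                             ∎

module _ {n} (G : Graph n) {u v : Fin n} (uv : adj G u v ≡ true) where
  private
    A = adj G
    B = pivotAdj A u v
    u≢v = edge-distinct G uv
    avoids : ∀ T → lookup T u ≡ false → lookup T v ≡ false → Avoids u v (members T)
    avoids T Tu Tv m = ∉members T Tu m , ∉members T Tv m

  pivot-minor-outside : ∀ T → lookup T u ≡ false → lookup T v ≡ false →
                        minorOn B T ≡ minorOn A (toggle u (toggle v T))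
  pivot-minor-outside T Tu Tv =
    trans (elimination G uv (members T) (avoids T Tu Tv))
          (sym (minor-perm A (members-toggle₂ u v T Tu Tv u≢v)))

  pivot-minor-exchange : ∀ T → lookup T u ≡ false → lookup T v ≡ false →
                         minorOn B (toggle u T) ≡ minorOn A (toggle v T)
  pivot-minor-exchange T Tu Tv =
    trans (minor-perm B (members-toggle u T Tu))
    (trans (exchange G uv (members T) (avoids T Tu Tv))
           (sym (minor-perm A (members-toggle v T Tv))))

pivot-minor : ∀ {n} (G : Graph n) {u v} (uv : adj G u v ≡ true) → ∀ T →
              minorOn (pivotAdj (adj G) u v) T ≡ minorOn (adj G) (toggle u (toggle v T))
pivot-minor G {u} {v} uv T = by-cases (lookup T u) (lookup T v) refl refl
  where
  open ≡-Reasoning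
  A = adj G
  B = pivotAdj A u v
  u≢v = edge-distinct G uv
  v≢u = ≢-sym u≢v
  by-cases : ∀ a b → lookup T u ≡ a → lookup T v ≡ b → minorOn B T ≡ minorOn A (toggle u (toggle v T))
  by-cases false false Tu Tv = pivot-minor-outside G uv T Tu Tv
  -- u, v ∈ T: the outside case for G[uv], whose pivot on uv is G again
  by-cases true  true  Tu Tv = begin
    minorOn B T                          ≡⟨ cong (minorOn B) (sym (toggle-twice u v T)) ⟩
    minorOn B (toggle u (toggle v T′))   ≡⟨ sym (pivot-minor-outside (pivotGraph G u v) (pivot-edge G uv) T′ T′u T′v) ⟩
    minorOn (pivotAdj B u v) T′          ≡⟨ minorOn-cong (pivot-involutive G uv) T′ ⟩
    minorOn A T′                         ∎
    where
    T′ = toggle u (toggle v T)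
    T′u : lookup T′ u ≡ false
    T′u = trans (lookup-toggle-self u (toggle v T)) (cong not (trans (toggle-other T v≢u) Tu))
    T′v : lookup T′ v ≡ false
    T′v = trans (toggle-other (toggle v T) u≢v) (trans (lookup-toggle-self v T) (cong not Tv))
  by-cases true  false Tu Tv = begin
    minorOn B T                          ≡⟨ cong (minorOn B) (sym (toggle-involutive u T)) ⟩
    minorOn B (toggle u T₀)              ≡⟨ pivot-minor-exchange G uv T₀ T₀u T₀v ⟩
    minorOn A (toggle v T₀)              ≡⟨ cong (minorOn A) (toggle-comm v u T) ⟩
    minorOn A (toggle u (toggle v T))    ∎
    where
    T₀ = toggle u T
    T₀u = trans (lookup-toggle-self u T) (cong not Tu)
    T₀v = trans (toggle-other T u≢v) Tv
  by-cases false true  Tu Tv = begin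
    minorOn B T                          ≡⟨ minorOn-cong (pivot-comm A u v) T ⟩
    minorOn (pivotAdj A v u) T           ≡⟨ cong (minorOn (pivotAdj A v u)) (sym (toggle-involutive v T)) ⟩
    minorOn (pivotAdj A v u) (toggle v T₀) ≡⟨ pivot-minor-exchange G (edge-sym G uv) T₀ T₀v T₀u ⟩
    minorOn A (toggle u T₀)              ∎
    where
    T₀ = toggle v T
    T₀v = trans (lookup-toggle-self v T) (cong not Tv)
    T₀u = trans (toggle-other T v≢u) Tu

supp-cons : ∀ {n} (u v : Fin n) φ → supp ((u , v) ∷ φ) ≡ toggle u (toggle v (supp φ))
supp-cons u v φ = tabulate-cong λ x →
  cong ((u == x) xor_) (sym (trans (lookup-toggle v (supp φ) x) (cong ((v == x) xor_) (lookup∘tabulate _ x))))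

supp-empty : ∀ {n} → members (supp {n} []) ≡ []
supp-empty {zero}  = refl
supp-empty {suc n} = cong (map suc) (supp-empty {n})

soundness : ∀ {n} (G : Graph n) φ → Applicable (adj G) φ → minorOn (adj G) (supp φ) ≡ true
soundness G []              _          = cong (λ l → minor (adj G) l l) supp-empty
soundness G ((u , v) ∷ φ) (uv , app) = begin
  minorOn (adj G) (supp ((u , v) ∷ φ))         ≡⟨ cong (minorOn (adj G)) (supp-cons u v φ) ⟩
  minorOn (adj G) (toggle u (toggle v (supp φ))) ≡⟨ sym (pivot-minor G uv (supp φ)) ⟩
  minorOn (pivotAdj (adj G) u v) (supp φ)      ≡⟨ soundness (pivotGraph G u v) φ app ⟩
  true                                         ∎
  where open ≡-Reasoning

-- A witness for S: an applicable reduced sequence with support S, all of whose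
-- vertices lie in S (the last field drives the induction for reducedness).
record Realisation {n} (G : Graph n) (S : Subset n) : Set where
  field
    sequence   : PivotSeq n
    applicable : Applicable (adj G) sequence
    support    : supp sequence ≡ S
    reduced    : Reduced sequence
    inside     : All (λ x → lookup S x ≡ true) (vertices sequence)
open Realisation

realise-empty : ∀ {n} (G : Graph n) S → members S ≡ [] → Realisation G S
realise-empty G S none = record
  { sequence = [] ; applicable = _ ; reduced = [] ; inside = []
  ; support  = vec-ext (supp []) S (λ x → trans (lookup∘tabulate _ x) (sym (absent x)))
  }
  where
  absent : ∀ x → lookup S x ≡ false
  absent x with lookup S x in Sx
  ... | false = refl
  ... | true  with subst (x ∈_) none (⇒∈members S Sx)
  ...   | ()

separated : ∀ {n} (T : Subset n) {x y} → lookup T x ≡ false → lookup T y ≡ true → x ≢ y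
separated T Tx Ty refl with trans (sym Tx) Ty
... | ()

module Removal {n} (S : Subset n) {u v : Fin n}
               (Su : lookup S u ≡ true) (Sv : lookup S v ≡ true) (u≢v : u ≢ v) where
  T : Subset n
  T = toggle u (toggle v S)

  T-u : lookup T u ≡ false
  T-u = trans (lookup-toggle-self u (toggle v S)) (cong not (trans (toggle-other S (≢-sym u≢v)) Su))

  T-v : lookup T v ≡ false
  T-v = trans (toggle-other (toggle v S) u≢v) (trans (lookup-toggle-self v S) (cong not Sv))

  members-T : members S ↭ u ∷ v ∷ members T
  members-T = subst (λ X → members X ↭ u ∷ v ∷ members T) (toggle-twice u v S)
                    (members-toggle₂ u v T T-u T-v u≢v)

  T⊆S : ∀ {y} → lookup T y ≡ true → lookup S y ≡ true
  T⊆S {y} Ty = trans (cong (λ X → lookup X y) (sym (toggle-twice u v S)))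
    (trans (toggle-other (toggle v T) (separated T T-u Ty)) (trans (toggle-other T (separated T T-v Ty)) Ty))

completeness : ∀ k {n} (G : Graph n) S → length (members S) ≤ k → minorOn (adj G) S ≡ true →
               Realisation G S
pivot-step   : ∀ k {n} (G : Graph n) S u ms → members S ≡ u ∷ ms → length (u ∷ ms) ≤ k →
               minorOn (adj G) S ≡ true → Realisation G S

completeness k G S len h = by-members (members S) refl
  where
  by-members : ∀ l → members S ≡ l → Realisation G S
  by-members []       eq = realise-empty G S eq
  by-members (u ∷ ms) eq = pivot-step k G S u ms eq (subst (λ l → length l ≤ k) eq len) h

pivot-step (suc k) G S u ms eq (s≤s len) h = record
  { sequence   = (u , v) ∷ sequence r
  ; applicable = uv , applicable r
  ; support    = trans (supp-cons u v (sequence r))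
                       (trans (cong (λ X → toggle u (toggle v X)) (support r)) (toggle-twice u v S))
  ; reduced    = (u≢v ∷ All.map (separated T T-u) (inside r)) ∷ (All.map (separated T T-v) (inside r) ∷ reduced r)
  ; inside     = Su ∷ Sv ∷ All.map T⊆S (inside r)
  }
  where
  A = adj G
  edge = minor-nonzeroRow A u ms (u ∷ ms) (subst (λ l → minor A l l ≡ true) eq h)
  v = proj₁ edge
  uv : A u v ≡ true
  uv = proj₂ (proj₂ edge)
  u≢v = edge-distinct G uv
  Su : lookup S u ≡ true
  Su = ∈members⇒ S (subst (u ∈_) (sym eq) (here refl))
  Sv : lookup S v ≡ true
  Sv = ∈members⇒ S (subst (v ∈_) (sym eq) (proj₁ (proj₂ edge)))
  open Removal S Su Sv u≢v
  smaller : length (members T) ≤ k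
  smaller = ≤-trans (n≤1+n _) (subst (_≤ k) (suc-injective (trans (cong length (sym eq)) (↭-length members-T))) len)
  r = completeness k (pivotGraph G u v) T smaller
        (trans (pivot-minor G uv T) (trans (cong (minorOn A) (toggle-twice u v S)) h))

theorem6 : ∀ {n} (G : Graph n) (S : Subset n) →
    ((detInduced G S ≡ true →
        ∃[ φ ] (Applicable (adj G) φ × supp φ ≡ S × Reduced φ))
    × ((∃[ φ ] (Applicable (adj G) φ × supp φ ≡ S)) →
        detInduced G S ≡ true))
theorem6 G S = realise , sound
  where
  realise : detInduced G S ≡ true → ∃[ φ ] (Applicable (adj G) φ × supp φ ≡ S × Reduced φ)
  realise h = sequence r , applicable r , support r , reduced r
    where r = completeness _ G S ≤-refl (trans (sym (det-induced (adj G) S)) h)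
  sound : ∃[ φ ] (Applicable (adj G) φ × supp φ ≡ S) → detInduced G S ≡ true
  sound (φ , app , refl) = trans (det-induced (adj G) (supp φ)) (soundness G φ app)
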